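{- Let $G=(V,E)$ be an undirected graph, $W\subseteq V$, let $T$ be a partial Steiner tree of $(G,W)$ (with at least one vertex), let $w\in W\setminus V(T)$, and let $P$ be a $V(T)$-$w$ path in $G$. Then $P$ is the unique $V(T)$-$w$ path in $G$ if and only if every edge of $P$ is a bridge of $G$.
   Context: A partial Steiner tree of $(G,W)$ is a subgraph $T$ of $G$ that is a tree all of whose leaves belong to $W$. For $X\subseteq V$ and $w\notin X$, an $X$-$w$ path is a path with one end vertex in $X$, the other end vertex $w$, and no internal vertex in $X\cup\{w\}$. A bridge is an edge whose removal increases the number of connected components. -}

module Defs where

open import Data.Nat using (ℕ; _<_; _≤_)
open import Data.Fin using (Fin)
open import Data.List using (List; []; _∷_; _++_; length)
open import Data.List.Relation.Unary.All using (All)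
open import Data.List.Relation.Unary.Linked using (Linked)
open import Data.List.Relation.Unary.Unique.Propositional using (Unique)
open import Data.Product using (Σ; ∃; _×_; _,_)
open import Data.Sum using (_⊎_)
open import Data.Empty using (⊥)
open import Relation.Nullary using (¬_)
open import Relation.Binary.PropositionalEquality using (_≡_; _≢_)
open import Function.Bundles using (_⇔_)

record Graph (n : ℕ) : Set₁ where
  field
    Adj    : Fin n → Fin n → Set
    sym    : ∀ {x y} → Adj x y → Adj y x
    irrefl : ∀ {x} → ¬ Adj x x
open Graph public

VSet : ℕ → Set₁
VSet n = Fin n → Set

data Walk {n : ℕ} (R : Fin n → Fin n → Set) : Fin n → Fin n → Set where
  nil  : ∀ {x} → Walk R x x
  cons : ∀ {x y z} → R x y → Walk R y z → Walk R x z

Connected : ∀ {n} → Graph n → Fin n → Fin n → Set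
Connected G x y = Walk (Adj G) x y

-- "G has exactly k connected components": a surjective labelling of the
-- vertices by Fin k whose fibres are exactly the connected components.
HasComponents : ∀ {n} → Graph n → ℕ → Set
HasComponents {n} G k =
  Σ (Fin n → Fin k) λ c →
    (∀ j → ∃ λ i → c i ≡ j) ×
    (∀ i j → (c i ≡ c j) ⇔ Connected G i j)

SameEdge : ∀ {n} → Fin n → Fin n → Fin n → Fin n → Set
SameEdge u v x y = (x ≡ u × y ≡ v) ⊎ (x ≡ v × y ≡ u)

deleteEdge : ∀ {n} → (G : Graph n) → Fin n → Fin n → Graph n
deleteEdge G u v = record
  { Adj    = λ x y → Adj G x y × ¬ SameEdge u v x y
  ; sym    = λ { (a , ne) → sym G a , λ { (_⊎_.inj₁ (p , q)) → ne (_⊎_.inj₂ (q , p))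
                                       ; (_⊎_.inj₂ (p , q)) → ne (_⊎_.inj₁ (q , p)) } }
  ; irrefl = λ { (a , _) → irrefl G a }
  }

IsBridge : ∀ {n} → Graph n → Fin n → Fin n → Set
IsBridge G u v =
  Adj G u v ×
  (∀ k k' → HasComponents G k → HasComponents (deleteEdge G u v) k' → k < k')

record Subgraph {n : ℕ} (G : Graph n) : Set₁ where
  field
    VT      : VSet n
    ET      : Fin n → Fin n → Set
    ET-sym  : ∀ {x y} → ET x y → ET y x
    ET-adj  : ∀ {x y} → ET x y → Adj G x y
    ET-ends : ∀ {x y} → ET x y → VT x × VT y
open Subgraph public

HasCycle : ∀ {n} {G : Graph n} → Subgraph G → Set
HasCycle {n} T =
  Σ (Fin n) λ x → Σ (List (Fin n)) λ rest →
    2 ≤ length rest × Unique (x ∷ rest) × Linked (ET T) (x ∷ rest ++ x ∷ [])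

IsTree : ∀ {n} {G : Graph n} → Subgraph G → Set
IsTree T =
  (∀ x y → VT T x → VT T y → Walk (ET T) x y) × ¬ HasCycle T

IsLeaf : ∀ {n} {G : Graph n} → Subgraph G → Fin n → Set
IsLeaf T v = VT T v × ∃ λ u → ET T v u × (∀ u' → ET T v u' → u' ≡ u)

IsPartialSteinerTree : ∀ {n} (G : Graph n) → VSet n → Subgraph G → Set
IsPartialSteinerTree G W T = IsTree T × (∀ v → IsLeaf T v → W v)

IsXwPath : ∀ {n} → Graph n → VSet n → Fin n → List (Fin n) → Set
IsXwPath {n} G X w P =
  Σ (Fin n) λ x → Σ (List (Fin n)) λ mid →
    P ≡ x ∷ mid ++ w ∷ [] ×
    X x ×
    All (λ v → ¬ X v × v ≢ w) mid ×
    Linked (Adj G) P ×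
    Unique P

data EdgeOf {n : ℕ} : Fin n → Fin n → List (Fin n) → Set where
  here  : ∀ {a b xs} → EdgeOf a b (a ∷ b ∷ xs)
  there : ∀ {a b x xs} → EdgeOf a b xs → EdgeOf a b (x ∷ xs)

-- Write X = V(T). An edge ab is a bridge iff G - ab has no a-b walk: a walk would leave the
-- components unchanged, and otherwise the components of G - ab refine those of G and separate a
-- from b. Constructively the component counts exist only up to double negation, which suffices
-- since they are only used to refute such a walk. If P is the unique X-w path and G - ab had an
-- a-b walk for an edge ab of P, rerouting P along it would give an X-w walk in G - ab, hence an
-- X-w path other than P. Conversely, if all edges of P are bridges, the first edge xp of P is the
-- first edge of every X-w path Q, for otherwise T, the first edge of Q and the tails of P and Q
-- would join x to p in G - xp; adding p to X and repeating along P gives Q = P.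
module Submission where

open import Defs
open import Data.Nat using (ℕ; zero; suc; _<_; s≤s)
open import Data.Nat.Properties using (<-irrefl)
open import Data.Fin using (Fin; zero; suc; punchOut; _≟_)
open import Data.Fin.Properties using (any?; suc-injective; punchOut-injective; injective⇒≤)
open import Data.List using (List; []; _∷_; _++_)
open import Data.List.Membership.Propositional using (_∈_)
open import Data.List.Relation.Unary.All as All using (All; []; _∷_)
open import Data.List.Relation.Unary.All.Properties using (++⁺; ++⁻ˡ; ¬Any⇒All¬)
open import Data.List.Relation.Unary.Any using (here; there)
import Data.List.Relation.Unary.Any as Any
open import Data.List.Relation.Unary.AllPairs using ([]; _∷_)
open import Data.List.Relation.Unary.Linked as Linked using (Linked; [-]; _∷_)
open import Data.List.Relation.Unary.Unique.Propositional using (Unique)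
open import Data.Product using (Σ; ∃; _×_; _,_; proj₁; proj₂)
open import Data.Sum using (_⊎_; inj₁; inj₂; [_,_])
open import Data.Empty using (⊥-elim)
open import Function using (_∘_)
open import Function.Bundles using (_⇔_; mk⇔; Equivalence)
open import Relation.Nullary using (¬_; Dec; yes; no)
open import Relation.Nullary.Decidable using (_×-dec_; _⊎-dec_; ¬¬-excluded-middle)
open import Relation.Binary.Definitions using (Decidable)
open import Relation.Binary.Structures using (IsEquivalence)
open import Relation.Binary.PropositionalEquality as ≡ using (_≡_; _≢_; refl; cong; subst)
open import Relation.Unary using (_∪_; ｛_｝)

open Equivalence using (to; from)

module _ {n} {R : Fin n → Fin n → Set} where

  infixr 5 _++ʷ_
  _++ʷ_ : ∀ {x y z} → Walk R x y → Walk R y z → Walk R x z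
  nil      ++ʷ q = q
  cons e p ++ʷ q = cons e (p ++ʷ q)

  reverseʷ : (∀ {x y} → R x y → R y x) → ∀ {x y} → Walk R x y → Walk R y x
  reverseʷ sym nil        = nil
  reverseʷ sym (cons e p) = reverseʷ sym p ++ʷ cons (sym e) nil

  vertices : ∀ {u w} → Walk R u w → List (Fin n)
  vertices {u} nil        = u ∷ []
  vertices {u} (cons _ p) = u ∷ vertices p

  initVertices : ∀ {u w} → Walk R u w → List (Fin n)
  initVertices nil            = []
  initVertices {u} (cons _ p) = u ∷ initVertices p

  vertices≡initVertices++ : ∀ {u w} (p : Walk R u w) → vertices p ≡ initVertices p ++ w ∷ []
  vertices≡initVertices++ nil        = refl
  vertices≡initVertices++ (cons _ p) = cong (_ ∷_) (vertices≡initVertices++ p)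

  vertices-linked : ∀ {u w} (p : Walk R u w) → Linked R (vertices p)
  vertices-linked nil                 = [-]
  vertices-linked (cons e nil)        = e ∷ [-]
  vertices-linked (cons e (cons f p)) = e ∷ vertices-linked (cons f p)

  All-vertices-first : ∀ {P : Fin n → Set} {u w} (p : Walk R u w) → All P (vertices p) → P u
  All-vertices-first nil        (Pu ∷ _) = Pu
  All-vertices-first (cons _ _) (Pu ∷ _) = Pu

  All-vertices-last : ∀ {P : Fin n → Set} {u w} (p : Walk R u w) → All P (vertices p) → P w
  All-vertices-last nil        (Pw ∷ _)  = Pw
  All-vertices-last (cons _ p) (_ ∷ Ps) = All-vertices-last p Ps

  suffixFrom : ∀ {u v w} (p : Walk R v w) → u ∈ vertices p → Walk R u w
  suffixFrom nil        (here refl) = nil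
  suffixFrom (cons e p) (here refl) = cons e p
  suffixFrom (cons _ p) (there u∈p) = suffixFrom p u∈p

  suffixFrom-preserves : (Q : List (Fin n) → Set) → (∀ {x xs} → Q (x ∷ xs) → Q xs) →
                         ∀ {u v w} (p : Walk R v w) (u∈p : u ∈ vertices p) →
                         Q (vertices p) → Q (vertices (suffixFrom p u∈p))
  suffixFrom-preserves Q Q-tail nil        (here refl) Qp = Qp
  suffixFrom-preserves Q Q-tail (cons _ _) (here refl) Qp = Qp
  suffixFrom-preserves Q Q-tail (cons _ p) (there u∈p) Qp =
    suffixFrom-preserves Q Q-tail p u∈p (Q-tail Qp)

  linked⇒walk : ∀ {x w} mid → Linked R (x ∷ mid ++ w ∷ []) → Walk R x w
  linked⇒walk []        (e ∷ [-]) = cons e nil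
  linked⇒walk (_ ∷ mid) (e ∷ es)  = cons e (linked⇒walk mid es)

mapʷ : ∀ {n} {R S : Fin n → Fin n → Set} → (∀ {x y} → R x y → S x y) →
       ∀ {x y} → Walk R x y → Walk S x y
mapʷ f nil        = nil
mapʷ f (cons e p) = cons (f e) (mapʷ f p)

linked-edge : ∀ {n} {R : Fin n → Fin n → Set} {a b L} → Linked R L → EdgeOf a b L → R a b
linked-edge (r ∷ _)  here         = r
linked-edge (_ ∷ rs) (there ab∈L) = linked-edge rs ab∈L
linked-edge [-]      (there ())

connected-isEquivalence : ∀ {n} (G : Graph n) → IsEquivalence (Connected G)
connected-isEquivalence G = record { refl = nil ; sym = reverseʷ (sym G) ; trans = _++ʷ_ }

¬¬-∀-Fin : ∀ {n} {P : Fin n → Set} → (∀ i → ¬ ¬ P i) → ¬ ¬ (∀ i → P i)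
¬¬-∀-Fin {zero}  _   k = k (λ ())
¬¬-∀-Fin {suc n} ¬¬P k =
  ¬¬P zero λ P₀ → ¬¬-∀-Fin (¬¬P ∘ suc) λ Pₛ → k λ { zero → P₀ ; (suc i) → Pₛ i }

¬¬-decidable-Fin : ∀ {n} {P : Fin n → Set} → ¬ ¬ (∀ i → Dec (P i))
¬¬-decidable-Fin = ¬¬-∀-Fin (λ _ → ¬¬-excluded-middle)

Classes : ∀ {n} → (Fin n → Fin n → Set) → ℕ → Set
Classes {n} R k =
  Σ (Fin n → Fin k) λ c → (∀ j → ∃ λ i → c i ≡ j) × (∀ i j → (c i ≡ c j) ⇔ R i j)

-- Vertex 0 either joins the class of some R-related vertex, or forms a class of its own.
classes : ∀ {n} {R : Fin n → Fin n → Set} → IsEquivalence R → Decidable R → ∃ (Classes R)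
classes {zero} _ _ = 0 , (λ ()) , (λ ()) , (λ ())
classes {suc n} {R} R-equiv R? = extend (classes R⁺-equiv (λ i j → R? (suc i) (suc j)))
                                        (any? (λ i → R? zero (suc i)))
  where
  module R = IsEquivalence R-equiv
  R⁺ : Fin n → Fin n → Set
  R⁺ i j = R (suc i) (suc j)
  R⁺-equiv : IsEquivalence R⁺
  R⁺-equiv = record { refl = R.refl ; sym = R.sym ; trans = R.trans }

  extend : ∃ (Classes R⁺) → Dec (∃ λ i → R zero (suc i)) → ∃ (Classes R)
  extend (k , c , surj , iff) (yes (i₀ , R0i₀)) = k , c′ , surj′ , iff′
    where
    c′ : Fin (suc n) → Fin k
    c′ zero    = c i₀
    c′ (suc i) = c i
    surj′ : ∀ j → ∃ λ i → c′ i ≡ j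
    surj′ j = suc (proj₁ (surj j)) , proj₂ (surj j)
    iff′ : ∀ i j → (c′ i ≡ c′ j) ⇔ R i j
    iff′ zero    zero    = mk⇔ (λ _ → R.refl) (λ _ → refl)
    iff′ zero    (suc j) = mk⇔ (R.trans R0i₀ ∘ to (iff i₀ j)) (from (iff i₀ j) ∘ R.trans (R.sym R0i₀))
    iff′ (suc i) zero    = mk⇔ (λ eq → R.trans (to (iff i i₀) eq) (R.sym R0i₀))
                               (λ Ri0 → from (iff i i₀) (R.trans Ri0 R0i₀))
    iff′ (suc i) (suc j) = iff i j
  extend (k , c , surj , iff) (no ¬R0) = suc k , c′ , surj′ , iff′
    where
    c′ : Fin (suc n) → Fin (suc k)
    c′ zero    = zero
    c′ (suc i) = suc (c i)
    surj′ : ∀ j → ∃ λ i → c′ i ≡ j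
    surj′ zero    = zero , refl
    surj′ (suc j) = suc (proj₁ (surj j)) , cong suc (proj₂ (surj j))
    iff′ : ∀ i j → (c′ i ≡ c′ j) ⇔ R i j
    iff′ zero    zero    = mk⇔ (λ _ → R.refl) (λ _ → refl)
    iff′ zero    (suc j) = mk⇔ (λ ()) (λ R0j → ⊥-elim (¬R0 (j , R0j)))
    iff′ (suc i) zero    = mk⇔ (λ ()) (λ Ri0 → ⊥-elim (¬R0 (i , R.sym Ri0)))
    iff′ (suc i) (suc j) = mk⇔ (to (iff i j) ∘ suc-injective) (cong suc ∘ from (iff i j))

¬¬-hasComponents : ∀ {n} (G : Graph n) → ¬ ¬ ∃ (HasComponents G)
¬¬-hasComponents G k = ¬¬-∀-Fin (λ _ → ¬¬-decidable-Fin) λ G? →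
  k (classes (connected-isEquivalence G) G?)

classes-resp : ∀ {n} {R S : Fin n → Fin n → Set} {k} →
               (∀ i j → R i j ⇔ S i j) → Classes R k → Classes S k
classes-resp R⇔S (c , surj , iff) =
  c , surj , λ i j → mk⇔ (to (R⇔S i j) ∘ to (iff i j)) (from (iff i j) ∘ from (R⇔S i j))

injective-missing⇒< : ∀ {k k′} (g : Fin k → Fin k′) → (∀ {x y} → g x ≡ g y → x ≡ y) →
                      (e : Fin k′) → (∀ s → g s ≢ e) → k < k′
injective-missing⇒< {k′ = suc _} g g-inj e g≢e = s≤s (injective⇒≤ g′-inj)
  where
  e≢g : ∀ s → e ≢ g s
  e≢g s = g≢e s ∘ ≡.sym
  g′-inj : ∀ {x y} → punchOut (e≢g x) ≡ punchOut (e≢g y) → x ≡ y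
  g′-inj eq = g-inj (punchOut-injective (e≢g _) (e≢g _) eq)

-- The S-classes of representatives of the R-classes are distinct and miss that of a or of b.
classes-< : ∀ {n} {R S : Fin n → Fin n → Set} {k k′ a b} →
            (∀ {i j} → S i j → R i j) → R a b → ¬ S a b →
            Classes R k → Classes S k′ → k < k′
classes-< {R = R} {S} {k} {k′} {a} {b} S⊆R Rab ¬Sab (c , c-surj , c-iff) (c′ , _ , c′-iff) =
  missing (any? (λ s → g s ≟ c′ a))
  where
  rep : Fin k → _
  rep s = proj₁ (c-surj s)
  g : Fin k → Fin k′
  g s = c′ (rep s)
  g≡c′⇒≡c : ∀ {s v} → g s ≡ c′ v → s ≡ c v
  g≡c′⇒≡c {s} {v} eq = ≡.trans (≡.sym (proj₂ (c-surj s)))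
                                (from (c-iff (rep s) v) (S⊆R (to (c′-iff (rep s) v) eq)))
  g-inj : ∀ {x y} → g x ≡ g y → x ≡ y
  g-inj {y = y} eq = ≡.trans (g≡c′⇒≡c eq) (proj₂ (c-surj y))
  hits-both⇒Sab : ∀ {s₁ s₂} → g s₁ ≡ c′ a → g s₂ ≡ c′ b → S a b
  hits-both⇒Sab {s₁} {s₂} eq₁ eq₂ = to (c′-iff a b) (begin
    c′ a  ≡⟨ ≡.sym eq₁ ⟩
    g s₁  ≡⟨ cong g s₁≡s₂ ⟩
    g s₂  ≡⟨ eq₂ ⟩
    c′ b  ∎)
    where
    open ≡.≡-Reasoning
    s₁≡s₂ : s₁ ≡ s₂
    s₁≡s₂ = ≡.trans (g≡c′⇒≡c eq₁) (≡.trans (from (c-iff a b) Rab) (≡.sym (g≡c′⇒≡c eq₂)))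
  missing : Dec (∃ λ s → g s ≡ c′ a) → k < k′
  missing (yes (s₁ , eq₁)) = injective-missing⇒< g g-inj (c′ b) λ s₂ eq₂ → ¬Sab (hits-both⇒Sab eq₁ eq₂)
  missing (no ¬hit)        = injective-missing⇒< g g-inj (c′ a) λ s eq → ¬hit (s , eq)

SameEdge⇒∋ˡ : ∀ {n} {c d u v : Fin n} → SameEdge c d u v → c ≡ u ⊎ c ≡ v
SameEdge⇒∋ˡ (inj₁ (u≡c , _)) = inj₁ (≡.sym u≡c)
SameEdge⇒∋ˡ (inj₂ (_ , v≡c)) = inj₂ (≡.sym v≡c)

SameEdge⇒∋ʳ : ∀ {n} {c d u v : Fin n} → SameEdge c d u v → d ≡ u ⊎ d ≡ v
SameEdge⇒∋ʳ (inj₁ (_ , v≡d)) = inj₂ (≡.sym v≡d)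
SameEdge⇒∋ʳ (inj₂ (u≡d , _)) = inj₁ (≡.sym u≡d)

module _ {n} (G : Graph n) (a b : Fin n) where

  liftʷ : Walk (Adj (deleteEdge G a b)) a b →
          ∀ {x y} → Walk (Adj G) x y → Walk (Adj (deleteEdge G a b)) x y
  liftʷ a⇝b nil = nil
  liftʷ a⇝b (cons {x} {y} e p) with ((x ≟ a) ×-dec (y ≟ b)) ⊎-dec ((x ≟ b) ×-dec (y ≟ a))
  ... | yes (inj₁ (refl , refl)) = a⇝b ++ʷ liftʷ a⇝b p
  ... | yes (inj₂ (refl , refl)) = reverseʷ (sym (deleteEdge G a b)) a⇝b ++ʷ liftʷ a⇝b p
  ... | no ¬ab                   = cons (e , ¬ab) (liftʷ a⇝b p)

  bridge⇒¬walk : IsBridge G a b → ¬ Walk (Adj (deleteEdge G a b)) a b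
  bridge⇒¬walk (_ , fewer) a⇝b = ¬¬-hasComponents G λ { (k , comps) →
    <-irrefl refl (fewer k k comps (classes-resp same-connectivity comps)) }
    where
    same-connectivity : ∀ i j → Connected G i j ⇔ Connected (deleteEdge G a b) i j
    same-connectivity i j = mk⇔ (liftʷ a⇝b) (mapʷ proj₁)

  ¬walk⇒bridge : Adj G a b → ¬ Walk (Adj (deleteEdge G a b)) a b → IsBridge G a b
  ¬walk⇒bridge ab ¬a⇝b = ab , λ k k′ → classes-< (mapʷ proj₁) (cons ab nil) ¬a⇝b

xwPath-mono : ∀ {n} {G H : Graph n} {X : VSet n} {w Q} → (∀ {u v} → Adj H u v → Adj G u v) →
              IsXwPath H X w Q → IsXwPath G X w Q
xwPath-mono H⊆G (x , mid , eq , Xx , out , lk , un) = x , mid , eq , Xx , out , Linked.map H⊆G lk , un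

xwPath-linked : ∀ {n} {H : Graph n} {X : VSet n} {w Q} → IsXwPath H X w Q → Linked (Adj H) Q
xwPath-linked (_ , _ , _ , _ , _ , lk , _) = lk

-- Scanning the walk backwards, keep a path to w avoiding X (loop-erasing it) until the
-- first vertex in X is met.
module _ {n} (H : Graph n) {X : VSet n} (X? : ∀ v → Dec (X v)) {w : Fin n} (¬Xw : ¬ X w) where

  OutsidePath : Fin n → Set
  OutsidePath u = Σ (Walk (Adj H) u w) λ p → Unique (vertices p) × All (¬_ ∘ X) (vertices p)

  initVertices-outside : ∀ {u} (p : Walk (Adj H) u w) →
                         Unique (vertices p) → All (¬_ ∘ X) (vertices p) →
                         All (λ v → ¬ X v × v ≢ w) (initVertices p)
  initVertices-outside nil        _          _          = []
  initVertices-outside (cons _ p) (u∉p ∷ un) (¬Xu ∷ out) =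
    (¬Xu , All-vertices-last p u∉p) ∷ initVertices-outside p un out

  xwPath-or-outside : ∀ {u} → Walk (Adj H) u w → (∃ λ Q → IsXwPath H X w Q) ⊎ OutsidePath u
  xwPath-or-outside nil = inj₂ (nil , [] ∷ [] , ¬Xw ∷ [])
  xwPath-or-outside (cons {u} e p) with xwPath-or-outside p
  ... | inj₁ Q = inj₁ Q
  ... | inj₂ (s , un , out) with X? u
  ...   | yes Xu = inj₁ (u ∷ vertices s , u , initVertices s ,
                         cong (u ∷_) (vertices≡initVertices++ s) ,
                         Xu , initVertices-outside s un out , vertices-linked (cons e s) ,
                         All.map (λ ¬Xv u≡v → ¬Xv (subst X u≡v Xu)) out ∷ un)
  ...   | no ¬Xu with Any.any? (u ≟_) (vertices s)
  ...     | yes u∈s = inj₂ (suffixFrom s u∈s ,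
                            suffixFrom-preserves (λ L → Unique L × All (¬_ ∘ X) L)
                              (λ { (_ ∷ un′ , _ ∷ out′) → un′ , out′ }) s u∈s (un , out))
  ...     | no u∉s  = inj₂ (cons e s , ¬Any⇒All¬ _ u∉s ∷ un , ¬Xu ∷ out)

  walk⇒xwPath : ∀ {x} → X x → Walk (Adj H) x w → ∃ λ Q → IsXwPath H X w Q
  walk⇒xwPath Xx p =
    [ (λ Q → Q) , (λ (s , _ , out) → ⊥-elim (All-vertices-first s out Xx)) ] (xwPath-or-outside p)

unique⇒bridges : ∀ {n} (G : Graph n) {X : VSet n} {w P} → ¬ X w → IsXwPath G X w P →
                 (∀ Q → IsXwPath G X w Q → Q ≡ P) → ∀ a b → EdgeOf a b P → IsBridge G a b
unique⇒bridges G ¬Xw (x , mid , refl , Xx , _ , lk , _) unique a b ab∈P =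
  ¬walk⇒bridge G a b (linked-edge lk ab∈P) λ a⇝b → ¬¬-decidable-Fin λ X? →
    let Q , Q-path = walk⇒xwPath (deleteEdge G a b) X? ¬Xw Xx (liftʷ G a b a⇝b (linked⇒walk mid lk))
        Q≡P        = unique Q (xwPath-mono {G = G} {H = deleteEdge G a b} proj₁ Q-path)
        Q-linked   = xwPath-linked {H = deleteEdge G a b} Q-path
    in proj₂ (linked-edge (subst (Linked _) Q≡P Q-linked) ab∈P) (inj₁ (refl , refl))

second : ∀ {n} → Fin n → List (Fin n) → Fin n
second w []      = w
second w (m ∷ _) = m

linked-first : ∀ {n} {R : Fin n → Fin n → Set} {x w} mid →
               Linked R (x ∷ mid ++ w ∷ []) → R x (second w mid)
linked-first []      (r ∷ _) = r
linked-first (_ ∷ _) (r ∷ _) = r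

edgeOf-first : ∀ {n} {x w : Fin n} mid → EdgeOf x (second w mid) (x ∷ mid ++ w ∷ [])
edgeOf-first []      = here
edgeOf-first (_ ∷ _) = here

All-second : ∀ {n} {P : Fin n → Set} {w} mid → All P (mid ++ w ∷ []) → P (second w mid)
All-second []      (Pw ∷ _) = Pw
All-second (_ ∷ _) (Pm ∷ _) = Pm

module _ {n} (G : Graph n) where

  InducedAdj : VSet n → Fin n → Fin n → Set
  InducedAdj X u v = Adj G u v × X u × X v

  InducedConnected : VSet n → Set
  InducedConnected X = ∀ {x y} → X x → X y → Walk (InducedAdj X) x y

  InducedConnected-∪ : ∀ {X x m} → InducedConnected X → X x → Adj G x m → InducedConnected (X ∪ ｛ m ｝)
  InducedConnected-∪ {X} {x} {m} X-conn Xx xm = connect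
    where
    widen : ∀ {u v} → InducedAdj X u v → InducedAdj (X ∪ ｛ m ｝) u v
    widen (e , Xu , Xv) = e , inj₁ Xu , inj₁ Xv
    connect : InducedConnected (X ∪ ｛ m ｝)
    connect (inj₁ Xu)   (inj₁ Xv)   = mapʷ widen (X-conn Xu Xv)
    connect (inj₁ Xu)   (inj₂ refl) = mapʷ widen (X-conn Xu Xx) ++ʷ cons (xm , inj₁ Xx , inj₂ refl) nil
    connect (inj₂ refl) (inj₁ Xv)   = cons (sym G xm , inj₂ refl , inj₁ Xx) (mapʷ widen (X-conn Xx Xv))
    connect (inj₂ refl) (inj₂ refl) = nil

  avoiding-walk : ∀ {c d x w} mid →
                  Linked (Adj G) (x ∷ mid ++ w ∷ []) → All (c ≢_) (x ∷ mid ++ w ∷ []) →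
                  Walk (Adj (deleteEdge G c d)) x w
  avoiding-walk []        (e ∷ [-]) (c≢x ∷ c≢w ∷ []) = cons (e , [ c≢x , c≢w ] ∘ SameEdge⇒∋ˡ) nil
  avoiding-walk (_ ∷ mid) (e ∷ es)  (c≢x ∷ c≢s)     =
    cons (e , [ c≢x , All.head c≢s ] ∘ SameEdge⇒∋ˡ) (avoiding-walk mid es c≢s)

  bridge-first-edge : ∀ {X x p y q w} → InducedConnected X → X x → ¬ X p →
                      ¬ Walk (Adj (deleteEdge G x p)) x p → Walk (Adj (deleteEdge G x p)) p w →
                      X y → Adj G y q → Walk (Adj (deleteEdge G x p)) q w → y ≡ x × q ≡ p
  bridge-first-edge {X} {x} {p} {y} {q} {w} X-conn Xx ¬Xp bridge p⇝w Xy yq q⇝w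
    with (y ≟ x) ×-dec (q ≟ p)
  ... | yes same     = same
  ... | no different = ⊥-elim (bridge (mapʷ inside (X-conn Xx Xy) ++ʷ cons (yq , ¬xp) (q⇝w ++ʷ p⇝w⁻¹)))
    where
    ∉X : ∀ {u} → X u → p ≢ u
    ∉X Xu p≡u = ¬Xp (subst X (≡.sym p≡u) Xu)
    inside : ∀ {u v} → InducedAdj X u v → Adj (deleteEdge G x p) u v
    inside (e , Xu , Xv) = e , [ ∉X Xu , ∉X Xv ] ∘ SameEdge⇒∋ʳ
    ¬xp : ¬ SameEdge x p y q
    ¬xp (inj₁ y≡x×q≡p) = different y≡x×q≡p
    ¬xp (inj₂ (y≡p , _)) = ∉X Xy (≡.sym y≡p)
    p⇝w⁻¹ : Walk (Adj (deleteEdge G x p)) w p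
    p⇝w⁻¹ = reverseʷ (sym (deleteEdge G x p)) p⇝w

  record IsXwPathVia (X : VSet n) (w x : Fin n) (mid : List (Fin n)) : Set where
    constructor xwPath
    field
      start   : X x
      outside : All (λ v → ¬ X v × v ≢ w) mid
      linked  : Linked (Adj G) (x ∷ mid ++ w ∷ [])
      unique  : Unique (x ∷ mid ++ w ∷ [])
  open IsXwPathVia

  IsXwPathVia-tail : ∀ {X w x m mid} → IsXwPathVia X w x (m ∷ mid) → IsXwPathVia (X ∪ ｛ m ｝) w m mid
  IsXwPathVia-tail {X} {w} {m = m} {mid} (xwPath _ (_ ∷ out) (_ ∷ lk) (_ ∷ m∉ ∷ un)) =
    xwPath (inj₂ refl) (All.zipWith outside-∪ (out , ++⁻ˡ mid m∉)) lk (m∉ ∷ un)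
    where
    outside-∪ : ∀ {v} → (¬ X v × v ≢ w) × m ≢ v → ¬ (X ∪ ｛ m ｝) v × v ≢ w
    outside-∪ ((¬Xv , v≢w) , m≢v) = [ ¬Xv , m≢v ] , v≢w

  outside⁺ : ∀ {X w x mid} → IsXwPathVia X w x mid → ¬ X w → All (¬_ ∘ X) (mid ++ w ∷ [])
  outside⁺ P ¬Xw = ++⁺ (All.map proj₁ (outside P)) (¬Xw ∷ [])

  tail-walk : ∀ {X w c d y} mid → X c → ¬ X w → IsXwPathVia X w y mid →
              Walk (Adj (deleteEdge G c d)) (second w mid) w
  tail-walk []        _  _   _ = nil
  tail-walk {X} {w} {c} (_ ∷ mid) Xc ¬Xw P =
    avoiding-walk mid (Linked.tail (linked P)) (All.map c≢ (outside⁺ P ¬Xw))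
    where
    c≢ : ∀ {v} → ¬ X v → c ≢ v
    c≢ ¬Xv c≡v = ¬Xv (subst X c≡v Xc)

  xwPath-unique : ∀ {X w} → InducedConnected X → ¬ X w →
                  ∀ x mid → IsXwPathVia X w x mid →
                  (∀ {a b} → EdgeOf a b (x ∷ mid ++ w ∷ []) → ¬ Walk (Adj (deleteEdge G a b)) a b) →
                  ∀ y mid₂ → IsXwPathVia X w y mid₂ →
                  _≡_ {A = List (Fin n)} (y ∷ mid₂ ++ w ∷ []) (x ∷ mid ++ w ∷ [])
  xwPath-unique X-conn ¬Xw x mid P bridges y mid₂ Q
    with bridge-first-edge X-conn (start P) (All-second mid (outside⁺ P ¬Xw))
           (bridges (edgeOf-first mid)) (tail-walk mid (start P) ¬Xw P)
           (start Q) (linked-first mid₂ (linked Q)) (tail-walk mid₂ (start P) ¬Xw Q)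
  xwPath-unique X-conn ¬Xw x []      P bridges .x []      Q | refl , _   = refl
  xwPath-unique X-conn ¬Xw x []      P bridges .x (_ ∷ _) Q | refl , m≡w =
    ⊥-elim (proj₂ (All.head (outside Q)) m≡w)
  xwPath-unique X-conn ¬Xw x (_ ∷ _) P bridges .x []      Q | refl , w≡m =
    ⊥-elim (proj₂ (All.head (outside P)) (≡.sym w≡m))
  xwPath-unique {X} {w} X-conn ¬Xw x (m ∷ mid) P bridges .x (.m ∷ mid₂) Q | refl , refl =
    cong (x ∷_) (xwPath-unique X′-conn ¬X′w m mid (IsXwPathVia-tail P) (λ ab → bridges (there ab))
                               m mid₂ (IsXwPathVia-tail Q))
    where
    X′-conn : InducedConnected (X ∪ ｛ m ｝)
    X′-conn = InducedConnected-∪ X-conn (start P) (linked-first (m ∷ mid) (linked P))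
    ¬X′w : ¬ (X ∪ ｛ m ｝) w
    ¬X′w = [ ¬Xw , proj₂ (All.head (outside P)) ]

  all-bridges⇒unique : ∀ {X w P} → InducedConnected X → ¬ X w → IsXwPath G X w P →
                       (∀ a b → EdgeOf a b P → IsBridge G a b) → ∀ Q → IsXwPath G X w Q → Q ≡ P
  all-bridges⇒unique X-conn ¬Xw (x , mid , refl , Xx , out , lk , un) bridges
                     _ (y , mid₂ , refl , Xy , out₂ , lk₂ , un₂) =
    xwPath-unique X-conn ¬Xw x mid (xwPath Xx out lk un) (λ ab → bridge⇒¬walk G _ _ (bridges _ _ ab))
                  y mid₂ (xwPath Xy out₂ lk₂ un₂)

tree⇒inducedConnected : ∀ {n} {G : Graph n} (T : Subgraph G) → IsTree T → InducedConnected G (VT T)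
tree⇒inducedConnected T (T-conn , _) Tx Ty = mapʷ (λ e → ET-adj T e , ET-ends T e) (T-conn _ _ Tx Ty)

-- Only the connectivity of T matters: the conditions on its leaves, W and non-emptiness are unused.
lemma4p4 : ∀ {n} (G : Graph n) (W : VSet n) (T : Subgraph G) →
           IsPartialSteinerTree G W T →
           (∃ λ v → VT T v) →
           (w : Fin n) → W w → ¬ VT T w →
           (P : List (Fin n)) → IsXwPath G (VT T) w P →
           ((∀ Q → IsXwPath G (VT T) w Q → Q ≡ P)
             ⇔ (∀ a b → EdgeOf a b P → IsBridge G a b))
lemma4p4 G W T (tree , _) _ w _ w∉T P P-path =
  mk⇔ (unique⇒bridges G w∉T P-path)
      (all-bridges⇒unique G (tree⇒inducedConnected T tree) w∉T P-path)
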